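{- Let $(g(x),f(x))$ be a Riordan array and let $S=(g(x),f(x))\cdot\left(\frac{1}{1-x},x\right)^T$ be its row partial sum (the matrix with $(n,k)$-entry $\sum_{i=0}^k[x^n]g(x)f(x)^i$). Then $$H:=S^{ -1}=\overline{\left(\frac{ -g(x)}{1-f(x)},f(x)\right)^{ -1}},$$ that is, $S^{ -1}$ is the Riordan array $\left(\frac{ -g(x)}{1-f(x)},f(x)\right)^{ -1}$ with its top row (row $0$) removed.
   Context: Throughout, $g(x)=\sum_{i\ge0}g_ix^i$ and $f(x)=\sum_{i\ge1}f_ix^i$ are formal power series with integer coefficients, $g_0=1$, $f_1=1$. For a power series $u(x)$ with $u(0)\neq0$ and $v(x)$ with $v(0)=0$, $v'(0)\ne0$, the Riordan array $(u(x),v(x))$ is the infinite lower-triangular matrix with $(n,k)$-entry $[x^n]u(x)v(x)^k$ ($n,k\ge0$); its inverse is $\left(\frac{1}{u(\bar v)},\bar v\right)$ with $\bar v$ the compositional inverse of $v$. $\left(\frac{1}{1-x},x\right)^T$ is the upper-triangular all-ones matrix. For an infinite matrix $M$, $\overline{M}$ denotes the matrix obtained from $M$ by deleting its top row (so row $n$ of $\overline M$ is row $n+1$ of $M$). -}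

module Defs where

open import Data.Nat using (ℕ; zero; suc; _∸_)
open import Data.Integer using (ℤ; +_; _+_; _*_; -_; _-_)

Series : Set
Series = ℕ → ℤ

Matrix : Set
Matrix = ℕ → ℕ → ℤ

sumBelow : ℕ → (ℕ → ℤ) → ℤ
sumBelow zero    h = + 0
sumBelow (suc n) h = sumBelow n h + h n

δ : ℕ → ℕ → ℤ
δ zero    zero    = + 1
δ zero    (suc k) = + 0
δ (suc n) zero    = + 0
δ (suc n) (suc k) = δ n k

one : Series
one n = δ n 0

X : Series
X n = δ n 1

_⊝_ : Series → Series → Series
(a ⊝ b) n = a n - b n

neg : Series → Series
neg a n = - a n

_⊛_ : Series → Series → Series
(a ⊛ b) n = sumBelow (suc n) (λ i → a i * b (n ∸ i))

pow : Series → ℕ → Series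
pow a zero    = one
pow a (suc k) = a ⊛ pow a k

-- composition a(b(x)), meaningful when b 0 = 0: [x^n] Σ_k a_k b(x)^k
comp : Series → Series → Series
comp a b n = sumBelow (suc n) (λ k → a k * pow b k n)

riordan : Series → Series → Matrix
riordan u v n k = (u ⊛ pow v k) n

rowPartialSum : Series → Series → Matrix
rowPartialSum u v n k = sumBelow (suc k) (λ i → riordan u v n i)

deleteTopRow : Matrix → Matrix
deleteTopRow M n k = M (suc n) k

{-# OPTIONS --safe #-}
-- Writing u = -g/(1-f), the relation g = u f - u gives g f^i = u f^(i+1) - u f^i, so
-- column k of S telescopes to column k+1 minus column 0 of the Riordan array (u , f).
-- Since composition with fbar is multiplicative, (1/u(fbar) , fbar) is a left inverse of
-- (u , f); its row n+1 applied to the partial sums therefore gives δ(n+1,k+1) - δ(n+1,0) = δ(n,k).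
module Submission where

open import Defs
open import Data.Nat using (ℕ; suc)
open import Data.Integer using (ℤ; +_; _*_)
open import Relation.Binary.PropositionalEquality using (_≡_)

open import Data.Nat as ℕ using (zero; _∸_; _<_; _≤_; s≤s)
import Data.Nat.Properties as ℕP
open import Data.Integer using (_+_; _-_; -_)
import Data.Integer.Properties as ℤP
open import Data.Integer.Tactic.RingSolver using (solve-∀)
open import Data.Sum using (inj₁; inj₂)
open import Data.Empty using (⊥-elim)
open import Relation.Binary.PropositionalEquality using (_≢_; refl; sym; trans; cong; cong₂; module ≡-Reasoning)
open ≡-Reasoning

*-distribˡ-minus : ∀ x y z → x * (y - z) ≡ x * y - x * z
*-distribˡ-minus = solve-∀

*-distribʳ-minus : ∀ x y z → (y - z) * x ≡ y * x - z * x
*-distribʳ-minus = solve-∀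

sumBelow-cong< : ∀ N {h h′ : ℕ → ℤ} → (∀ i → i < N → h i ≡ h′ i) →
                 sumBelow N h ≡ sumBelow N h′
sumBelow-cong< zero    eq = refl
sumBelow-cong< (suc N) eq =
  cong₂ _+_ (sumBelow-cong< N (λ i i<N → eq i (ℕP.m<n⇒m<1+n i<N))) (eq N ℕP.≤-refl)

sumBelow-cong : ∀ N {h h′ : ℕ → ℤ} → (∀ i → h i ≡ h′ i) → sumBelow N h ≡ sumBelow N h′
sumBelow-cong N eq = sumBelow-cong< N (λ i _ → eq i)

sumBelow-vanishes : ∀ N {h : ℕ → ℤ} → (∀ i → i < N → h i ≡ + 0) → sumBelow N h ≡ + 0
sumBelow-vanishes zero    eq = refl
sumBelow-vanishes (suc N) eq =
  cong₂ _+_ (sumBelow-vanishes N (λ i i<N → eq i (ℕP.m<n⇒m<1+n i<N))) (eq N ℕP.≤-refl)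

sumBelow-extend : ∀ {N} M {h : ℕ → ℤ} → N ≤ M → (∀ i → N ≤ i → h i ≡ + 0) →
                  sumBelow M h ≡ sumBelow N h
sumBelow-extend zero ℕ.z≤n _ = refl
sumBelow-extend {N} (suc M) {h} N≤1+M tail with ℕP.m≤n⇒m<n∨m≡n N≤1+M
... | inj₂ refl = refl
... | inj₁ (s≤s N≤M) = begin
  sumBelow M h + h M  ≡⟨ cong₂ _+_ (sumBelow-extend M N≤M tail) (tail M N≤M) ⟩
  sumBelow N h + + 0  ≡⟨ ℤP.+-identityʳ _ ⟩
  sumBelow N h        ∎

sumBelow-distrib-+ : ∀ N (h h′ : ℕ → ℤ) →
                     sumBelow N (λ i → h i + h′ i) ≡ sumBelow N h + sumBelow N h′
sumBelow-distrib-+ zero    h h′ = refl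
sumBelow-distrib-+ (suc N) h h′ =
  trans (cong (_+ (h N + h′ N)) (sumBelow-distrib-+ N h h′))
        (interchange (sumBelow N h) (sumBelow N h′) (h N) (h′ N))
  where
  interchange : ∀ a b c d → (a + b) + (c + d) ≡ (a + c) + (b + d)
  interchange = solve-∀

sumBelow-distrib-minus : ∀ N (h h′ : ℕ → ℤ) →
                         sumBelow N (λ i → h i - h′ i) ≡ sumBelow N h - sumBelow N h′
sumBelow-distrib-minus zero    h h′ = refl
sumBelow-distrib-minus (suc N) h h′ =
  trans (cong (_+ (h N - h′ N)) (sumBelow-distrib-minus N h h′))
        (interchange (sumBelow N h) (sumBelow N h′) (h N) (h′ N))
  where
  interchange : ∀ a b c d → (a - b) + (c - d) ≡ (a + c) - (b + d)
  interchange = solve-∀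

*-distribˡ-sumBelow : ∀ N x (h : ℕ → ℤ) → x * sumBelow N h ≡ sumBelow N (λ i → x * h i)
*-distribˡ-sumBelow zero    x h = ℤP.*-zeroʳ x
*-distribˡ-sumBelow (suc N) x h =
  trans (ℤP.*-distribˡ-+ x (sumBelow N h) (h N)) (cong (_+ x * h N) (*-distribˡ-sumBelow N x h))

*-distribʳ-sumBelow : ∀ N x (h : ℕ → ℤ) → sumBelow N h * x ≡ sumBelow N (λ i → h i * x)
*-distribʳ-sumBelow zero    x h = refl
*-distribʳ-sumBelow (suc N) x h =
  trans (ℤP.*-distribʳ-+ x (sumBelow N h) (h N)) (cong (_+ h N * x) (*-distribʳ-sumBelow N x h))

sumBelow-product : ∀ N M (h h′ : ℕ → ℤ) →
                   sumBelow N h * sumBelow M h′ ≡ sumBelow N (λ i → sumBelow M (λ j → h i * h′ j))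
sumBelow-product N M h h′ =
  trans (*-distribʳ-sumBelow N (sumBelow M h′) h) (sumBelow-cong N (λ i → *-distribˡ-sumBelow M (h i) h′))

sumBelow-comm : ∀ N M (H : ℕ → ℕ → ℤ) →
                sumBelow N (λ i → sumBelow M (H i)) ≡ sumBelow M (λ j → sumBelow N (λ i → H i j))
sumBelow-comm zero    M H = sym (sumBelow-vanishes M (λ _ _ → refl))
sumBelow-comm (suc N) M H =
  trans (cong (_+ sumBelow M (H N)) (sumBelow-comm N M H)) (sym (sumBelow-distrib-+ M _ _))

sumBelow-telescope : ∀ k (h : ℕ → ℤ) → sumBelow k (λ i → h (suc i) - h i) ≡ h k - h 0
sumBelow-telescope zero    h = sym (ℤP.+-inverseʳ (h 0))
sumBelow-telescope (suc k) h =
  trans (cong (_+ (h (suc k) - h k)) (sumBelow-telescope k h)) (cancel (h k) (h 0) (h (suc k)))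
  where
  cancel : ∀ a b c → (a - b) + (c - a) ≡ c - b
  cancel = solve-∀

-- Both sides sum H i t over the triangle i + t ≤ n, by antidiagonals and by rows.
sumBelow-triangle : ∀ n (H : ℕ → ℕ → ℤ) →
                    sumBelow (suc n) (λ s → sumBelow (suc s) (λ i → H i (s ∸ i))) ≡
                    sumBelow (suc n) (λ i → sumBelow (suc (n ∸ i)) (H i))
sumBelow-triangle zero    H = refl
sumBelow-triangle (suc n) H = begin
  sumBelow (suc n) antidiagonals + (sumBelow (suc n) newDiagonal + H (suc n) (n ∸ n))
    ≡⟨ cong (_+ (sumBelow (suc n) newDiagonal + H (suc n) (n ∸ n))) (sumBelow-triangle n H) ⟩
  sumBelow (suc n) rows + (sumBelow (suc n) newDiagonal + H (suc n) (n ∸ n))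
    ≡⟨ regroup (sumBelow (suc n) rows) (sumBelow (suc n) newDiagonal) (H (suc n) (n ∸ n)) ⟩
  (sumBelow (suc n) rows + sumBelow (suc n) newDiagonal) + H (suc n) (n ∸ n)
    ≡⟨ cong₂ _+_ (sym (sumBelow-distrib-+ (suc n) rows newDiagonal)) lastRow ⟩
  sumBelow (suc n) (λ i → rows i + newDiagonal i) + sumBelow (suc (n ∸ n)) (H (suc n))
    ≡⟨ cong (_+ sumBelow (suc (n ∸ n)) (H (suc n))) (sumBelow-cong< (suc n) lengthenRow) ⟩
  sumBelow (suc n) (λ i → sumBelow (suc (suc n ∸ i)) (H i)) + sumBelow (suc (n ∸ n)) (H (suc n))
    ∎
  where
  antidiagonals rows newDiagonal : ℕ → ℤ
  antidiagonals s = sumBelow (suc s) (λ i → H i (s ∸ i))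
  rows i = sumBelow (suc (n ∸ i)) (H i)
  newDiagonal i = H i (suc n ∸ i)
  regroup : ∀ a b c → a + (b + c) ≡ (a + b) + c
  regroup = solve-∀
  lastRow : H (suc n) (n ∸ n) ≡ sumBelow (suc (n ∸ n)) (H (suc n))
  lastRow rewrite ℕP.n∸n≡0 n = sym (ℤP.+-identityˡ _)
  lengthenRow : ∀ i → i < suc n → rows i + newDiagonal i ≡ sumBelow (suc (suc n ∸ i)) (H i)
  lengthenRow i i<1+n rewrite ℕP.+-∸-assoc 1 (ℕP.m<1+n⇒m≤n i<1+n) = refl

δ-diag : ∀ n → δ n n ≡ + 1
δ-diag zero    = refl
δ-diag (suc n) = δ-diag n

δ-≢ : ∀ {m n} → m ≢ n → δ m n ≡ + 0
δ-≢ {zero}  {zero}  m≢n = ⊥-elim (m≢n refl)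
δ-≢ {zero}  {suc n} _   = refl
δ-≢ {suc m} {zero}  _   = refl
δ-≢ {suc m} {suc n} m≢n = δ-≢ (λ m≡n → m≢n (cong suc m≡n))

sumBelow-δ : ∀ {N t} (h : ℕ → ℤ) → t < N → sumBelow N (λ i → δ i t * h i) ≡ h t
sumBelow-δ {suc N} {t} h (s≤s t≤N) with ℕP.m≤n⇒m<n∨m≡n t≤N
... | inj₁ t<N = begin
  sumBelow N (λ i → δ i t * h i) + δ N t * h N
    ≡⟨ cong₂ _+_ (sumBelow-δ h t<N) (cong (_* h N) (δ-≢ (ℕP.>⇒≢ t<N))) ⟩
  h t + + 0
    ≡⟨ ℤP.+-identityʳ (h t) ⟩
  h t
    ∎
... | inj₂ refl = begin
  sumBelow t (λ i → δ i t * h i) + δ t t * h t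
    ≡⟨ cong₂ _+_ (sumBelow-vanishes t offDiagonal) (cong (_* h t) (δ-diag t)) ⟩
  + 0 + + 1 * h t
    ≡⟨ trans (ℤP.+-identityˡ _) (ℤP.*-identityˡ (h t)) ⟩
  h t
    ∎
  where
  offDiagonal : ∀ i → i < t → δ i t * h i ≡ + 0
  offDiagonal i i<t = cong (_* h i) (δ-≢ (ℕP.<⇒≢ i<t))

infix 4 _≈_
_≈_ : Series → Series → Set
a ≈ b = ∀ n → a n ≡ b n

⊛-cong : ∀ {a a′ b b′} → a ≈ a′ → b ≈ b′ → a ⊛ b ≈ a′ ⊛ b′
⊛-cong a≈a′ b≈b′ n = sumBelow-cong (suc n) (λ i → cong₂ _*_ (a≈a′ i) (b≈b′ (n ∸ i)))

⊛-congˡ : ∀ a {b b′} → b ≈ b′ → a ⊛ b ≈ a ⊛ b′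
⊛-congˡ a = ⊛-cong {a} (λ _ → refl)

⊛-congʳ : ∀ b {a a′} → a ≈ a′ → a ⊛ b ≈ a′ ⊛ b
⊛-congʳ b a≈a′ = ⊛-cong {b = b} a≈a′ (λ _ → refl)

⊛-identityˡ : ∀ a → one ⊛ a ≈ a
⊛-identityˡ a n = sumBelow-δ {suc n} (λ i → a (n ∸ i)) (s≤s ℕ.z≤n)

⊛-distribˡ-⊝ : ∀ a b c → a ⊛ (b ⊝ c) ≈ (a ⊛ b) ⊝ (a ⊛ c)
⊛-distribˡ-⊝ a b c n =
  trans (sumBelow-cong (suc n) (λ i → *-distribˡ-minus (a i) (b (n ∸ i)) (c (n ∸ i))))
        (sumBelow-distrib-minus (suc n) _ _)

⊛-distribʳ-⊝ : ∀ a b c → (b ⊝ c) ⊛ a ≈ (b ⊛ a) ⊝ (c ⊛ a)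
⊛-distribʳ-⊝ a b c n =
  trans (sumBelow-cong (suc n) (λ i → *-distribʳ-minus (a (n ∸ i)) (b i) (c i)))
        (sumBelow-distrib-minus (suc n) _ _)

sumBelow-⊛ : ∀ n a c (z : ℕ → ℤ) →
             sumBelow (suc n) (λ k → (a ⊛ c) k * z k) ≡
             sumBelow (suc n) (λ i → sumBelow (suc (n ∸ i)) (λ t → a i * c t * z (i ℕ.+ t)))
sumBelow-⊛ n a c z = begin
  sumBelow (suc n) (λ k → (a ⊛ c) k * z k)
    ≡⟨ sumBelow-cong (suc n) (λ k → trans (*-distribʳ-sumBelow (suc k) (z k) _)
                                          (sumBelow-cong< (suc k) (λ i i<1+k → degree k i (ℕP.m<1+n⇒m≤n i<1+k)))) ⟩
  sumBelow (suc n) (λ k → sumBelow (suc k) (λ i → H i (k ∸ i)))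
    ≡⟨ sumBelow-triangle n H ⟩
  sumBelow (suc n) (λ i → sumBelow (suc (n ∸ i)) (H i))
    ∎
  where
  H : ℕ → ℕ → ℤ
  H i t = a i * c t * z (i ℕ.+ t)
  degree : ∀ k i → i ≤ k → a i * c (k ∸ i) * z k ≡ H i (k ∸ i)
  degree k i i≤k = cong (λ m → a i * c (k ∸ i) * z m) (sym (ℕP.m+[n∸m]≡n i≤k))

⊛-assoc : ∀ a b c → (a ⊛ b) ⊛ c ≈ a ⊛ (b ⊛ c)
⊛-assoc a b c n =
  trans (sumBelow-⊛ n a b (λ s → c (n ∸ s)))
        (sumBelow-cong (suc n) (λ i → trans (sumBelow-cong (suc (n ∸ i)) (reassociate i))
                                            (sym (*-distribˡ-sumBelow (suc (n ∸ i)) (a i) _))))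
  where
  reassociate : ∀ i t → a i * b t * c (n ∸ (i ℕ.+ t)) ≡ a i * (b t * c (n ∸ i ∸ t))
  reassociate i t = trans (ℤP.*-assoc (a i) (b t) _)
                          (cong (λ m → a i * (b t * c m)) (sym (ℕP.∸-+-assoc n i t)))

pow-cong : ∀ {a a′} → a ≈ a′ → ∀ k → pow a k ≈ pow a′ k
pow-cong a≈a′ zero    n = refl
pow-cong a≈a′ (suc k)   = ⊛-cong a≈a′ (pow-cong a≈a′ k)

pow-+ : ∀ a i j → pow a i ⊛ pow a j ≈ pow a (i ℕ.+ j)
pow-+ a zero    j   = ⊛-identityˡ (pow a j)
pow-+ a (suc i) j n = trans (⊛-assoc a (pow a i) (pow a j) n) (⊛-congˡ a (pow-+ a i j) n)

pow-X : ∀ k n → pow X k n ≡ δ n k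
pow-X zero    n       = refl
pow-X (suc k) zero    = refl
pow-X (suc k) (suc n) =
  trans (sumBelow-δ {suc (suc n)} (λ i → pow X k (suc n ∸ i)) (s≤s (s≤s ℕ.z≤n))) (pow-X k n)

comp-one : ∀ b → comp one b ≈ one
comp-one b n = sumBelow-δ {suc n} (λ k → pow b k n) (s≤s ℕ.z≤n)

module _ (b : Series) (b₀ : b 0 ≡ + 0) where

  pow-vanishes : ∀ k {n} → n < k → pow b k n ≡ + 0
  pow-vanishes (suc k) {n} (s≤s n≤k) = sumBelow-vanishes (suc n) term
    where
    term : ∀ i → i < suc n → b i * pow b k (n ∸ i) ≡ + 0
    term zero    _         = cong (_* pow b k n) b₀
    term (suc i) (s≤s i<n) =
      trans (cong (b (suc i) *_) (pow-vanishes k (ℕP.<-≤-trans (ℕP.∸-monoʳ-< (s≤s ℕ.z≤n) i<n) n≤k)))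
            (ℤP.*-zeroʳ (b (suc i)))

  comp-extend : ∀ a {m N} → m < N → comp a b m ≡ sumBelow N (λ k → a k * pow b k m)
  comp-extend a {m} {N} m<N =
    sym (sumBelow-extend N m<N (λ k m<k → trans (cong (a k *_) (pow-vanishes k m<k)) (ℤP.*-zeroʳ (a k))))

  comp-⊛-expand : ∀ a c n →
    comp (a ⊛ c) b n ≡ sumBelow (suc n) (λ i → sumBelow (suc n) (λ t → a i * c t * pow b (i ℕ.+ t) n))
  comp-⊛-expand a c n =
    trans (sumBelow-⊛ n a c (λ k → pow b k n))
          (sumBelow-cong< (suc n) (λ i _ → sym (sumBelow-extend (suc n) (s≤s (ℕP.m∸n≤m n i)) (beyond i))))
    where
    beyond : ∀ i t → suc (n ∸ i) ≤ t → a i * c t * pow b (i ℕ.+ t) n ≡ + 0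
    beyond i t n∸i<t =
      trans (cong (a i * c t *_)
                  (pow-vanishes (i ℕ.+ t) (ℕP.≤-<-trans (ℕP.m≤n+m∸n n i) (ℕP.+-monoʳ-< i n∸i<t))))
            (ℤP.*-zeroʳ (a i * c t))

  comp⊛comp-expand : ∀ a c n →
    (comp a b ⊛ comp c b) n ≡
    sumBelow (suc n) (λ i → sumBelow (suc n) (λ t → a i * c t * pow b (i ℕ.+ t) n))
  comp⊛comp-expand a c n = begin
    sumBelow N (λ s → comp a b s * comp c b (n ∸ s))
      ≡⟨ sumBelow-cong< N (λ s s<N → cong₂ _*_ (comp-extend a s<N) (comp-extend c (s≤s (ℕP.m∸n≤m n s)))) ⟩
    sumBelow N (λ s → sumBelow N (λ i → a i * P i s) * sumBelow N (λ t → c t * P t (n ∸ s)))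
      ≡⟨ sumBelow-cong N (λ s → sumBelow-product N N _ _) ⟩
    sumBelow N (λ s → sumBelow N (λ i → sumBelow N (λ t → a i * P i s * (c t * P t (n ∸ s)))))
      ≡⟨ sumBelow-comm N N _ ⟩
    sumBelow N (λ i → sumBelow N (λ s → sumBelow N (λ t → a i * P i s * (c t * P t (n ∸ s)))))
      ≡⟨ sumBelow-cong N (λ i → sumBelow-comm N N _) ⟩
    sumBelow N (λ i → sumBelow N (λ t → sumBelow N (λ s → a i * P i s * (c t * P t (n ∸ s)))))
      ≡⟨ sumBelow-cong N (λ i → sumBelow-cong N (λ t → coefficient i t)) ⟩
    sumBelow N (λ i → sumBelow N (λ t → a i * c t * P (i ℕ.+ t) n))
      ∎
    where
    N = suc n
    P : ℕ → ℕ → ℤ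
    P k m = pow b k m
    rearrange : ∀ x p y q → x * p * (y * q) ≡ x * y * (p * q)
    rearrange = solve-∀
    coefficient : ∀ i t → sumBelow N (λ s → a i * P i s * (c t * P t (n ∸ s))) ≡ a i * c t * P (i ℕ.+ t) n
    coefficient i t = begin
      sumBelow N (λ s → a i * P i s * (c t * P t (n ∸ s)))
        ≡⟨ sumBelow-cong N (λ s → rearrange (a i) (P i s) (c t) (P t (n ∸ s))) ⟩
      sumBelow N (λ s → a i * c t * (P i s * P t (n ∸ s)))
        ≡⟨ sym (*-distribˡ-sumBelow N (a i * c t) _) ⟩
      a i * c t * (pow b i ⊛ pow b t) n
        ≡⟨ cong (a i * c t *_) (pow-+ b i t n) ⟩
      a i * c t * P (i ℕ.+ t) n
        ∎

  comp-⊛ : ∀ a c → comp (a ⊛ c) b ≈ comp a b ⊛ comp c b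
  comp-⊛ a c n = trans (comp-⊛-expand a c n) (sym (comp⊛comp-expand a c n))

  comp-pow : ∀ a k → comp (pow a k) b ≈ pow (comp a b) k
  comp-pow a zero      = comp-one b
  comp-pow a (suc k) n = trans (comp-⊛ a (pow a k) n) (⊛-congˡ (comp a b) (comp-pow a k) n)

  riordan-applyColumn : ∀ w a m → sumBelow (suc m) (λ j → riordan w b m j * a j) ≡ (w ⊛ comp a b) m
  riordan-applyColumn w a m = begin
    sumBelow N (λ j → sumBelow N (λ i → w i * pow b j (m ∸ i)) * a j)
      ≡⟨ sumBelow-cong N (λ j → *-distribʳ-sumBelow N (a j) _) ⟩
    sumBelow N (λ j → sumBelow N (λ i → w i * pow b j (m ∸ i) * a j))
      ≡⟨ sumBelow-comm N N _ ⟩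
    sumBelow N (λ i → sumBelow N (λ j → w i * pow b j (m ∸ i) * a j))
      ≡⟨ sumBelow-cong N (λ i → trans (sumBelow-cong N (λ j → rearrange (w i) (pow b j (m ∸ i)) (a j)))
                                       (sym (*-distribˡ-sumBelow N (w i) _))) ⟩
    sumBelow N (λ i → w i * sumBelow N (λ j → a j * pow b j (m ∸ i)))
      ≡⟨ sumBelow-cong N (λ i → cong (w i *_) (sym (comp-extend a (s≤s (ℕP.m∸n≤m m i))))) ⟩
    (w ⊛ comp a b) m
      ∎
    where
    N = suc m
    rearrange : ∀ x p y → x * p * y ≡ x * (y * p)
    rearrange = solve-∀

riordan-leftInverse : ∀ u f fbar w → fbar 0 ≡ + 0 → comp f fbar ≈ X → w ⊛ comp u fbar ≈ one →
                      ∀ m c → sumBelow (suc m) (λ j → riordan w fbar m j * riordan u f j c) ≡ δ m c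
riordan-leftInverse u f fbar w fbar₀ f∘fbar≈X w·u∘fbar≈1 m c = begin
  sumBelow (suc m) (λ j → riordan w fbar m j * (u ⊛ pow f c) j)
    ≡⟨ riordan-applyColumn fbar fbar₀ w (u ⊛ pow f c) m ⟩
  (w ⊛ comp (u ⊛ pow f c) fbar) m
    ≡⟨ ⊛-congˡ w composite m ⟩
  (w ⊛ (comp u fbar ⊛ pow X c)) m
    ≡⟨ sym (⊛-assoc w (comp u fbar) (pow X c) m) ⟩
  ((w ⊛ comp u fbar) ⊛ pow X c) m
    ≡⟨ ⊛-congʳ (pow X c) w·u∘fbar≈1 m ⟩
  (one ⊛ pow X c) m
    ≡⟨ ⊛-identityˡ (pow X c) m ⟩
  pow X c m
    ≡⟨ pow-X c m ⟩
  δ m c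
    ∎
  where
  composite : comp (u ⊛ pow f c) fbar ≈ comp u fbar ⊛ pow X c
  composite t = trans (comp-⊛ fbar fbar₀ u (pow f c) t)
                      (⊛-congˡ (comp u fbar)
                              (λ s → trans (comp-pow fbar fbar₀ f c s) (pow-cong f∘fbar≈X c s)) t)

numerator-of-quotient : ∀ g f u → u ⊛ (one ⊝ f) ≈ neg g → g ≈ (u ⊛ f) ⊝ (u ⊛ one)
numerator-of-quotient g f u u·[1-f]≈-g j =
  solve-for ((u ⊛ one) j) ((u ⊛ f) j) (g j) (trans (sym (⊛-distribˡ-⊝ u one f j)) (u·[1-f]≈-g j))
  where
  negate-difference : ∀ x y → - (x - y) ≡ y - x
  negate-difference = solve-∀
  solve-for : ∀ x y z → x - y ≡ - z → z ≡ y - x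
  solve-for x y z x-y≡-z =
    trans (sym (ℤP.neg-involutive z)) (trans (cong -_ (sym x-y≡-z)) (negate-difference x y))

riordan-columnDifference : ∀ g f u → g ≈ (u ⊛ f) ⊝ (u ⊛ one) →
                           ∀ j i → riordan g f j i ≡ riordan u f j (suc i) - riordan u f j i
riordan-columnDifference g f u g≈uf-u j i = begin
  (g ⊛ pow f i) j
    ≡⟨ ⊛-congʳ (pow f i) g≈uf-u j ⟩
  (((u ⊛ f) ⊝ (u ⊛ one)) ⊛ pow f i) j
    ≡⟨ ⊛-distribʳ-⊝ (pow f i) (u ⊛ f) (u ⊛ one) j ⟩
  ((u ⊛ f) ⊛ pow f i) j - ((u ⊛ one) ⊛ pow f i) j
    ≡⟨ cong₂ _-_ (⊛-assoc u f (pow f i) j)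
                 (trans (⊛-assoc u one (pow f i) j) (⊛-congˡ u (⊛-identityˡ (pow f i)) j)) ⟩
  (u ⊛ pow f (suc i)) j - (u ⊛ pow f i) j
    ∎

rowPartialSum-telescopes : ∀ g f u → g ≈ (u ⊛ f) ⊝ (u ⊛ one) →
                           ∀ j k → rowPartialSum g f j k ≡ riordan u f j (suc k) - riordan u f j 0
rowPartialSum-telescopes g f u g≈uf-u j k =
  trans (sumBelow-cong (suc k) (riordan-columnDifference g f u g≈uf-u j))
        (sumBelow-telescope (suc k) (riordan u f j))

mainTheorem7 :
  (g f : Series) → g 0 ≡ + 1 → f 0 ≡ + 0 → f 1 ≡ + 1 →
  -- u = -g/(1-f)
  (u : Series) → (∀ n → (u ⊛ (one ⊝ f)) n ≡ neg g n) →
  -- fbar = compositional inverse of f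
  (fbar : Series) → fbar 0 ≡ + 0 → (∀ n → comp f fbar n ≡ X n) →
  -- w = 1 / u(fbar)
  (w : Series) → (∀ n → (w ⊛ comp u fbar) n ≡ one n) →
  -- H = deleteTopRow of the inverse Riordan array (w , fbar); H times S = I
  ∀ n k →
    sumBelow (suc (suc n))
      (λ j → deleteTopRow (riordan w fbar) n j * rowPartialSum g f j k)
    ≡ δ n k
mainTheorem7 g f _ _ _ u u·[1-f]≈-g fbar fbar₀ f∘fbar≈X w w·u∘fbar≈1 n k = begin
  sumBelow (suc (suc n)) (λ j → H j * rowPartialSum g f j k)
    ≡⟨ sumBelow-cong (suc (suc n)) (λ j → cong (H j *_) (rowPartialSum-telescopes g f u g≈uf-u j k)) ⟩
  sumBelow (suc (suc n)) (λ j → H j * (riordan u f j (suc k) - riordan u f j 0))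
    ≡⟨ sumBelow-cong (suc (suc n)) (λ j → *-distribˡ-minus (H j) _ _) ⟩
  sumBelow (suc (suc n)) (λ j → H j * riordan u f j (suc k) - H j * riordan u f j 0)
    ≡⟨ sumBelow-distrib-minus (suc (suc n)) _ _ ⟩
  sumBelow (suc (suc n)) (λ j → H j * riordan u f j (suc k))
    - sumBelow (suc (suc n)) (λ j → H j * riordan u f j 0)
    ≡⟨ cong₂ _-_ (inverse (suc n) (suc k)) (inverse (suc n) 0) ⟩
  δ n k - + 0
    ≡⟨ ℤP.+-identityʳ (δ n k) ⟩
  δ n k
    ∎
  where
  H : ℕ → ℤ
  H = deleteTopRow (riordan w fbar) n
  g≈uf-u : g ≈ (u ⊛ f) ⊝ (u ⊛ one)
  g≈uf-u = numerator-of-quotient g f u u·[1-f]≈-g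
  inverse : ∀ m c → sumBelow (suc m) (λ j → riordan w fbar m j * riordan u f j c) ≡ δ m c
  inverse = riordan-leftInverse u f fbar w fbar₀ f∘fbar≈X w·u∘fbar≈1
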